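{- Let $\tau$ be a nonempty triangular partition. Let $t^-=\max_{c\in\tau}\frac{\operatorname{leg}(c)}{\operatorname{arm}(c)+\operatorname{leg}(c)+1}$ and $t^+=\min_{c\in\tau}\frac{\operatorname{leg}(c)+1}{\operatorname{arm}(c)+\operatorname{leg}(c)+1}$. Let $m^-=\max_{(a,b)\in\tau}\big(t^-a+(1-t^-)b\big)$, let $C^-$ be the set of cells of $\tau$ attaining this maximum, and let $c^-$ be the rightmost cell of $C^-$. Similarly let $m^+=\max_{(a,b)\in\tau}\big(t^+a+(1-t^+)b\big)$, let $C^+$ be the set of cells attaining it, and let $c^+$ be the uppermost cell of $C^+$. If $c^-=c^+$, then this is the only removable cell of $\tau$. If $c^-\neq c^+$, then both $c^-$ and $c^+$ are removable cells of $\tau$.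
   Context: $\mathbb{N}$ denotes the positive integers. A partition $\lambda=\lambda_1\dots\lambda_k$ is identified with its Ferrers diagram $\{(a,b)\in\mathbb{N}^2:1\le b\le k,\,1\le a\le\lambda_b\}$ (points called cells). $\lambda'$ denotes the conjugate partition. For a cell $c=(i,j)$, $\operatorname{arm}(c)=\lambda_j-i$ and $\operatorname{leg}(c)=\lambda'_i-j$. A partition $\tau$ is triangular if there are real $r,s>0$ such that $\tau$ is exactly the set of points of $\mathbb{N}^2$ on or below the line $x/r+y/s=1$. A cell $c\in\tau$ is removable if $\tau\setminus\{c\}$ is triangular.
   Formalization: The numbers $r,s>0$ cutting out a triangular set of cells range over the positive rationals instead of the positive reals. -}

module Defs where

open import Data.Nat as ℕ using (ℕ; zero; suc; _∸_; _≤?_)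
open import Data.List using (List; []; _∷_; length; filter)
open import Data.List.Relation.Unary.All using (All)
open import Data.List.Relation.Unary.Linked using (Linked)
open import Data.Integer using (+_)
open import Data.Rational as ℚ using (ℚ; 0ℚ; 1ℚ; _<_; _≤_; _+_; _*_; _-_; _÷_; >-nonZero)
open import Data.Product using (Σ; _×_; _,_)
open import Relation.Binary.PropositionalEquality using (_≡_; _≢_)
open import Relation.Nullary using (¬_)

-- A cell (a , b) : column a, row b (both ≥ 1 for actual cells).
Cell : Set
Cell = ℕ × ℕ

IsPartition : List ℕ → Set
IsPartition τ = All (ℕ._<_ 0) τ × Linked ℕ._≥_ τ

-- part τ b = λ_b (1-indexed), and 0 if b = 0 or b > k.
part : List ℕ → ℕ → ℕ
part []       _             = 0
part (x ∷ xs) zero          = 0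
part (x ∷ xs) (suc zero)    = x
part (x ∷ xs) (suc (suc n)) = part xs (suc n)

conj : List ℕ → ℕ → ℕ
conj τ i = length (filter (i ≤?_) τ)

-- Membership of a cell in the Ferrers diagram:
-- 1 ≤ b ≤ k and 1 ≤ a ≤ λ_b   (b ≤ k is implied by 1 ≤ a ≤ λ_b).
_∈τ_ : Cell → List ℕ → Set
(a , b) ∈τ τ = 1 ℕ.≤ a × 1 ℕ.≤ b × a ℕ.≤ part τ b

arm : List ℕ → Cell → ℕ
arm τ (i , j) = part τ j ∸ i

leg : List ℕ → Cell → ℕ
leg τ (i , j) = conj τ i ∸ j

⟦_⟧ : ℕ → ℚ
⟦ n ⟧ = + n ℚ./ 1

lowerRatio : List ℕ → Cell → ℚ
lowerRatio τ c = + leg τ c ℚ./ suc (arm τ c ℕ.+ leg τ c)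

upperRatio : List ℕ → Cell → ℚ
upperRatio τ c = + suc (leg τ c) ℚ./ suc (arm τ c ℕ.+ leg τ c)

weight : ℚ → Cell → ℚ
weight t (a , b) = t * ⟦ a ⟧ + (1ℚ - t) * ⟦ b ⟧

IsTriangular : (Cell → Set) → Set
IsTriangular S =
  Σ ℚ λ r → Σ ℚ λ s → Σ (0ℚ < r) λ r>0 → Σ (0ℚ < s) λ s>0 →
    ∀ a b →
      (S (a , b) → 1 ℕ.≤ a × 1 ℕ.≤ b ×
         (_÷_ ⟦ a ⟧ r {{>-nonZero r>0}}) + (_÷_ ⟦ b ⟧ s {{>-nonZero s>0}}) ≤ 1ℚ)
    × (1 ℕ.≤ a × 1 ℕ.≤ b ×
         (_÷_ ⟦ a ⟧ r {{>-nonZero r>0}}) + (_÷_ ⟦ b ⟧ s {{>-nonZero s>0}}) ≤ 1ℚ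
       → S (a , b))

Triangular : List ℕ → Set
Triangular τ = IsTriangular (λ c → c ∈τ τ)

Removable : List ℕ → Cell → Set
Removable τ c = c ∈τ τ × IsTriangular (λ d → d ∈τ τ × d ≢ c)

IsMaxOver : List ℕ → (Cell → ℚ) → ℚ → Set
IsMaxOver τ f x = Σ Cell (λ c → c ∈τ τ × f c ≡ x) × (∀ c → c ∈τ τ → f c ≤ x)

IsMinOver : List ℕ → (Cell → ℚ) → ℚ → Set
IsMinOver τ f x = Σ Cell (λ c → c ∈τ τ × f c ≡ x) × (∀ c → c ∈τ τ → x ≤ f c)

IsRightmostMaximizer : List ℕ → ℚ → ℚ → Cell → Set
IsRightmostMaximizer τ t m (a , b) =
  (a , b) ∈τ τ × weight t (a , b) ≡ m ×
  (∀ a' b' → (a' , b') ∈τ τ → weight t (a' , b') ≡ m → a' ℕ.≤ a)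

IsUppermostMaximizer : List ℕ → ℚ → ℚ → Cell → Set
IsUppermostMaximizer τ t m (a , b) =
  (a , b) ∈τ τ × weight t (a , b) ≡ m ×
  (∀ a' b' → (a' , b') ∈τ τ → weight t (a' , b') ≡ m → b' ℕ.≤ b)

{-# OPTIONS --safe #-}
module Submission where

-- A line u a + v b = M with u, v > 0 cuts out τ exactly when every hook (arm α, leg β) has
-- β v < (α + 1) u and α u < (β + 1) v, i.e. leg/(arm+leg+1) < u/(u+v) < (leg+1)/(arm+leg+1):
-- the admissible slopes form the open interval (t⁻, t⁺), and it suffices to check the two cells
-- e⁻, e⁺ at which t⁻ and t⁺ are attained.
--
-- For large N the level (N β⁻ + 1) a + N (α⁻ + 1) b has slope just above t⁻ and equals
-- N·(cleared t⁻-weight) + a, so it orders cells by t⁻-weight and then by column.  The rightmost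
-- maximiser c⁻ is therefore the unique highest cell, and lowering the threshold below it cuts
-- out τ ∖ {c⁻}; symmetrically for c⁺.
--
-- If c⁻ = c⁺ = c₁ and a line (u, v) cuts out τ ∖ {c} with c ≠ c₁, then c is strictly higher
-- than c₁.  A slope ≤ t⁻ (≥ t⁺) would put the cell just past the row of e⁻ (column of e⁺) at
-- most as high as c₁; a slope in between makes c at most as high as c₁ when c is weakly left of
-- or weakly below c₁, and otherwise c lies north-east of c₁ and has larger t⁻-weight.

open import Defs
open import Data.Nat using (ℕ)
open import Data.List using (List; [])
open import Data.Rational using (ℚ)
open import Data.Product using (_×_; _,_; proj₁; proj₂)
open import Relation.Binary.PropositionalEquality using (_≡_; _≢_; refl; sym; subst)

module Embedding where

  open import Data.Nat as ℕ using (ℕ; suc)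
  import Data.Nat.Properties as ℕP
  import Data.Nat.Coprimality as Coprime
  open import Data.Integer as ℤ using (+_)
  import Data.Integer.Properties as ℤP
  open import Data.Rational
    using (mkℚ; toℚᵘ; positive; nonNegative; 0ℚ; _<_; _≤_; _+_; _*_; _-_; _/_; -_; *≤*; *<*)
  open import Data.Rational.Properties
  import Data.Rational.Unnormalised as ℚᵘ
  import Data.Rational.Unnormalised.Properties as ℚᵘP
  open import Data.Rational.Solver using (module +-*-Solver)
  open +-*-Solver using (solve; _:+_; _:*_; _:-_; _:=_)
  open import Data.Product using (_×_; _,_)
  open import Data.Sum using (_⊎_; inj₁; inj₂)
  open import Relation.Binary.PropositionalEquality
  open import Relation.Nullary using (¬_)

  ⟦⟧≡mkℚ : ∀ n → ⟦ n ⟧ ≡ mkℚ (+ n) 0 (Coprime.sym (Coprime.1-coprimeTo n))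
  ⟦⟧≡mkℚ n = ↥p/↧p≡p _

  ⟦⟧-+ : ∀ m n → ⟦ m ℕ.+ n ⟧ ≡ ⟦ m ⟧ + ⟦ n ⟧
  ⟦⟧-+ m n rewrite ⟦⟧≡mkℚ m | ⟦⟧≡mkℚ n =
    /-cong {+ (m ℕ.+ n)} {1} (sym (cong₂ ℤ._+_ (ℤP.*-identityʳ (+ m)) (ℤP.*-identityʳ (+ n)))) refl

  ⟦⟧-* : ∀ m n → ⟦ m ℕ.* n ⟧ ≡ ⟦ m ⟧ * ⟦ n ⟧
  ⟦⟧-* m n rewrite ⟦⟧≡mkℚ m | ⟦⟧≡mkℚ n = /-cong {+ (m ℕ.* n)} {1} (ℤP.pos-* m n) refl

  ⟦⟧-mono-≤ : ∀ {m n} → m ℕ.≤ n → ⟦ m ⟧ ≤ ⟦ n ⟧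
  ⟦⟧-mono-≤ {m} {n} m≤n rewrite ⟦⟧≡mkℚ m | ⟦⟧≡mkℚ n =
    *≤* (subst₂ ℤ._≤_ (sym (ℤP.*-identityʳ (+ m))) (sym (ℤP.*-identityʳ (+ n))) (ℤ.+≤+ m≤n))

  ⟦⟧-mono-< : ∀ {m n} → m ℕ.< n → ⟦ m ⟧ < ⟦ n ⟧
  ⟦⟧-mono-< {m} {n} m<n rewrite ⟦⟧≡mkℚ m | ⟦⟧≡mkℚ n =
    *<* (subst₂ ℤ._<_ (sym (ℤP.*-identityʳ (+ m))) (sym (ℤP.*-identityʳ (+ n))) (ℤ.+<+ m<n))

  ⟦⟧-cancel-≤ : ∀ {m n} → ⟦ m ⟧ ≤ ⟦ n ⟧ → m ℕ.≤ n
  ⟦⟧-cancel-≤ ⟦m⟧≤⟦n⟧ = ℕP.≮⇒≥ λ n<m → <-irrefl refl (<-≤-trans (⟦⟧-mono-< n<m) ⟦m⟧≤⟦n⟧)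

  ⟦⟧-cancel-< : ∀ {m n} → ⟦ m ⟧ < ⟦ n ⟧ → m ℕ.< n
  ⟦⟧-cancel-< ⟦m⟧<⟦n⟧ = ℕP.≰⇒> λ n≤m → <-irrefl refl (<-≤-trans ⟦m⟧<⟦n⟧ (⟦⟧-mono-≤ n≤m))

  ⟦⟧-nonNeg : ∀ n → 0ℚ ≤ ⟦ n ⟧
  ⟦⟧-nonNeg n = ⟦⟧-mono-≤ {0} {n} ℕ.z≤n

  ⟦⟧-pos : ∀ {n} → 1 ℕ.≤ n → 0ℚ < ⟦ n ⟧
  ⟦⟧-pos {n} = ⟦⟧-mono-< {0} {n}

  ⟦suc⟧-pos : ∀ n → 0ℚ < ⟦ suc n ⟧
  ⟦suc⟧-pos n = ⟦⟧-pos {suc n} (ℕ.s≤s ℕ.z≤n)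

  /-*-denominator : ∀ m d → (+ m / suc d) * ⟦ suc d ⟧ ≡ ⟦ m ⟧
  /-*-denominator m d = toℚᵘ-injective (begin
      toℚᵘ ((+ m / suc d) * ⟦ suc d ⟧)          ≈⟨ toℚᵘ-homo-* (+ m / suc d) ⟦ suc d ⟧ ⟩
      toℚᵘ (+ m / suc d) ℚᵘ.* toℚᵘ ⟦ suc d ⟧   ≈⟨ ℚᵘP.*-cong (toℚᵘ-fromℚᵘ (ℚᵘ.mkℚᵘ (+ m) d))
                                                               (ℚᵘP.≃-reflexive (cong toℚᵘ (⟦⟧≡mkℚ (suc d)))) ⟩
      ℚᵘ.mkℚᵘ (+ m) d ℚᵘ.* ℚᵘ.mkℚᵘ (+ suc d) 0 ≈⟨ ℚᵘ.*≡* cross ⟩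
      ℚᵘ.mkℚᵘ (+ m) 0                          ≈⟨ ℚᵘP.≃-reflexive (cong toℚᵘ (sym (⟦⟧≡mkℚ m))) ⟩
      toℚᵘ ⟦ m ⟧                                ∎)
    where
    open ℚᵘP.≃-Reasoning
    cross : (+ m ℤ.* + suc d) ℤ.* + 1 ≡ + m ℤ.* + suc (d ℕ.* 1)
    cross = trans (ℤP.*-identityʳ _) (cong (λ k → + m ℤ.* + suc k) (sym (ℕP.*-identityʳ d)))

  <⇒≱ : ∀ {p q} → p < q → ¬ (q ≤ p)
  <⇒≱ p<q q≤p = <-irrefl refl (<-≤-trans p<q q≤p)

  p≤q⇒0≤q-p : ∀ {p q} → p ≤ q → 0ℚ ≤ q - p
  p≤q⇒0≤q-p {p} {q} p≤q = subst (_≤ q - p) (+-inverseʳ p) (+-monoˡ-≤ (- p) p≤q)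

  p<q⇒0<q-p : ∀ {p q} → p < q → 0ℚ < q - p
  p<q⇒0<q-p {p} {q} p<q = subst (_< q - p) (+-inverseʳ p) (+-monoˡ-< (- p) p<q)

  q-p+p≡q : ∀ p q → q - p + p ≡ q
  q-p+p≡q = solve 2 (λ p q → q :- p :+ p := q) refl

  0≤q-p⇒p≤q : ∀ {p q} → 0ℚ ≤ q - p → p ≤ q
  0≤q-p⇒p≤q {p} {q} 0≤q-p = subst₂ _≤_ (+-identityˡ p) (q-p+p≡q p q) (+-monoˡ-≤ p 0≤q-p)

  0<q-p⇒p<q : ∀ {p q} → 0ℚ < q - p → p < q
  0<q-p⇒p<q {p} {q} 0<q-p = subst₂ _<_ (+-identityˡ p) (q-p+p≡q p q) (+-monoˡ-< p 0<q-p)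

  *-nonNeg : ∀ {p q} → 0ℚ ≤ p → 0ℚ ≤ q → 0ℚ ≤ p * q
  *-nonNeg {p} {q} 0≤p 0≤q = subst (_≤ p * q) (*-zeroʳ p) (*-monoˡ-≤-nonNeg p {{nonNegative 0≤p}} 0≤q)

  *-pos : ∀ {p q} → 0ℚ < p → 0ℚ < q → 0ℚ < p * q
  *-pos {p} {q} 0<p 0<q = subst (_< p * q) (*-zeroʳ p) (*-monoʳ-<-pos p {{positive 0<p}} 0<q)

  +-nonNeg : ∀ {p q} → 0ℚ ≤ p → 0ℚ ≤ q → 0ℚ ≤ p + q
  +-nonNeg 0≤p 0≤q = +-mono-≤ 0≤p 0≤q

  +-pos : ∀ {p q} → 0ℚ < p → 0ℚ ≤ q → 0ℚ < p + q
  +-pos 0<p 0≤q = +-mono-<-≤ 0<p 0≤q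

  pos+nonNeg+nonNeg≢0 : ∀ {x y z} → 0ℚ < x → 0ℚ ≤ y → 0ℚ ≤ z → x + y + z ≢ 0ℚ
  pos+nonNeg+nonNeg≢0 0<x 0≤y 0≤z sum≡0 = <-irrefl refl (subst (0ℚ <_) sum≡0 (+-pos (+-pos 0<x 0≤y) 0≤z))

  same-sign⇒0≤* : ∀ {p q m n} → (q ≤ p × m ℕ.≤ n) ⊎ (p ≤ q × n ℕ.≤ m) → 0ℚ ≤ (p - q) * (⟦ n ⟧ - ⟦ m ⟧)
  same-sign⇒0≤* (inj₁ (q≤p , m≤n)) = *-nonNeg (p≤q⇒0≤q-p q≤p) (p≤q⇒0≤q-p (⟦⟧-mono-≤ m≤n))
  same-sign⇒0≤* {p} {q} {m} {n} (inj₂ (p≤q , n≤m)) =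
    subst (0ℚ ≤_) (solve 4 (λ p q m n → (q :- p) :* (m :- n) := (p :- q) :* (n :- m)) refl p q ⟦ m ⟧ ⟦ n ⟧)
      (*-nonNeg (p≤q⇒0≤q-p p≤q) (p≤q⇒0≤q-p (⟦⟧-mono-≤ n≤m)))

module YoungDiagram where

  open import Data.Nat
  open import Data.Nat.Properties
  open import Data.List using (List; []; _∷_; length)
  open import Data.List.Properties using (filter-accept; filter-reject; length-filter)
  open import Data.List.Relation.Unary.Linked using (Linked; _∷_; tail)
  open import Data.Product using (_,_; proj₁; proj₂)
  open import Relation.Binary.PropositionalEquality
  open import Relation.Nullary using (¬_; Dec; yes; no)
  open import Data.Empty using (⊥-elim)

  Decreasing : List ℕ → Set
  Decreasing = Linked _≥_

  part≤head : ∀ {x xs} → Decreasing (x ∷ xs) → ∀ b → part (x ∷ xs) b ≤ x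
  part≤head _ zero = z≤n
  part≤head _ (suc zero) = ≤-refl
  part≤head {xs = []} _ (suc (suc b)) = z≤n
  part≤head {xs = y ∷ ys} (x≥y ∷ ↓) (suc (suc b)) = ≤-trans (part≤head ↓ (suc b)) x≥y

  conj-beyond-head : ∀ {x xs} a → Decreasing (x ∷ xs) → x < a → conj (x ∷ xs) a ≡ 0
  conj-beyond-head {xs = []} a _ x<a = cong length (filter-reject (a ≤?_) (<⇒≱ x<a))
  conj-beyond-head {xs = y ∷ ys} a (x≥y ∷ ↓) x<a =
    trans (cong length (filter-reject (a ≤?_) {xs = y ∷ ys} (<⇒≱ x<a))) (conj-beyond-head a ↓ (≤-<-trans x≥y x<a))

  ≤part⇒≤conj : ∀ {τ a b} → Decreasing τ → 1 ≤ a → 1 ≤ b → a ≤ part τ b → b ≤ conj τ a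
  ≤part⇒≤conj {[]} _ 1≤a _ a≤0 = ⊥-elim (<⇒≱ 1≤a a≤0)
  ≤part⇒≤conj {x ∷ xs} {a} {suc zero} _ _ _ a≤x rewrite filter-accept (a ≤?_) {xs = xs} a≤x = s≤s z≤n
  ≤part⇒≤conj {x ∷ xs} {a} {suc (suc b)} ↓ 1≤a _ a≤part with a ≤? x
  ... | no a≰x = ⊥-elim (a≰x (≤-trans a≤part (part≤head ↓ (suc (suc b)))))
  ... | yes a≤x rewrite filter-accept (a ≤?_) {xs = xs} a≤x = s≤s (≤part⇒≤conj (tail ↓) 1≤a (s≤s z≤n) a≤part)

  ≤conj⇒≤part : ∀ {τ a b} → Decreasing τ → 1 ≤ a → 1 ≤ b → b ≤ conj τ a → a ≤ part τ b
  ≤conj⇒≤part {[]} _ _ 1≤b b≤0 = ⊥-elim (<⇒≱ 1≤b b≤0)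
  ≤conj⇒≤part {x ∷ xs} {a} ↓ 1≤a 1≤b b≤conj with a ≤? x
  ... | no a≰x = ⊥-elim (<⇒≱ 1≤b (≤-trans b≤conj (≤-reflexive (conj-beyond-head a ↓ (≰⇒> a≰x)))))
  ≤conj⇒≤part {x ∷ xs} {a} {suc zero} ↓ 1≤a 1≤b b≤conj | yes a≤x = a≤x
  ≤conj⇒≤part {x ∷ xs} {a} {suc (suc b)} ↓ 1≤a 1≤b b≤conj | yes a≤x
    rewrite filter-accept (a ≤?_) {xs = xs} a≤x = ≤conj⇒≤part (tail ↓) 1≤a (s≤s z≤n) (s≤s⁻¹ b≤conj)

  _∈τ?_ : ∀ c τ → Dec (c ∈τ τ)
  (a , b) ∈τ? τ with 1 ≤? a | 1 ≤? b | a ≤? part τ b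
  ... | yes p | yes q | yes r = yes (p , q , r)
  ... | no ¬p | _     | _     = no (λ c∈τ → ¬p (proj₁ c∈τ))
  ... | yes _ | no ¬q | _     = no (λ c∈τ → ¬q (proj₁ (proj₂ c∈τ)))
  ... | yes _ | yes _ | no ¬r = no (λ c∈τ → ¬r (proj₂ (proj₂ c∈τ)))

  module _ {τ : List ℕ} (↓ : Decreasing τ) where

    part-antitone : ∀ {b b′} → 1 ≤ b′ → b′ ≤ b → part τ b ≤ part τ b′
    part-antitone {b} {b′} 1≤b′ b′≤b with part τ b in eq
    ... | zero = z≤n
    ... | suc k = ≤conj⇒≤part ↓ (s≤s z≤n) 1≤b′
                    (≤-trans b′≤b (≤part⇒≤conj ↓ (s≤s z≤n) (≤-trans 1≤b′ b′≤b) (≤-reflexive (sym eq))))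

    ∈τ⇒≤conj : ∀ {a b} → (a , b) ∈τ τ → b ≤ conj τ a
    ∈τ⇒≤conj (1≤a , 1≤b , a≤part) = ≤part⇒≤conj ↓ 1≤a 1≤b a≤part

    ∈τ-downClosed : ∀ {a b a′ b′} → (a , b) ∈τ τ → 1 ≤ a′ → 1 ≤ b′ → a′ ≤ a → b′ ≤ b → (a′ , b′) ∈τ τ
    ∈τ-downClosed (_ , _ , a≤part) 1≤a′ 1≤b′ a′≤a b′≤b =
      1≤a′ , 1≤b′ , ≤-trans a′≤a (≤-trans a≤part (part-antitone 1≤b′ b′≤b))

    column+arm≡part : ∀ {i j} → (i , j) ∈τ τ → i + arm τ (i , j) ≡ part τ j
    column+arm≡part (_ , _ , i≤part) = m+[n∸m]≡n i≤part

    row+leg≡conj : ∀ {i j} → (i , j) ∈τ τ → j + leg τ (i , j) ≡ conj τ i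
    row+leg≡conj c∈τ = m+[n∸m]≡n (∈τ⇒≤conj c∈τ)

    rowEnd∈τ : ∀ {i j} → (i , j) ∈τ τ → (part τ j , j) ∈τ τ
    rowEnd∈τ (1≤i , 1≤j , i≤part) = ≤-trans 1≤i i≤part , 1≤j , ≤-refl

    columnTop∈τ : ∀ {i j} → (i , j) ∈τ τ → (i , conj τ i) ∈τ τ
    columnTop∈τ {i} c∈τ@(1≤i , 1≤j , _) = 1≤i , 1≤conj , ≤conj⇒≤part ↓ 1≤i 1≤conj ≤-refl
      where
      1≤conj : 1 ≤ conj τ i
      1≤conj = ≤-trans 1≤j (∈τ⇒≤conj c∈τ)

    pastRowEnd∉τ : ∀ j → ¬ (suc (part τ j) , j) ∈τ τ
    pastRowEnd∉τ j (_ , _ , part<part) = n≮n _ part<part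

    pastColumnTop∉τ : ∀ i → ¬ (i , suc (conj τ i)) ∈τ τ
    pastColumnTop∉τ i c∈τ = n≮n _ (∈τ⇒≤conj c∈τ)

    column≤width : ∀ {a b} → (a , b) ∈τ τ → a ≤ part τ 1
    column≤width (_ , 1≤b , a≤part) = ≤-trans a≤part (part-antitone (s≤s z≤n) 1≤b)

    row≤height : ∀ {a b} → (a , b) ∈τ τ → b ≤ length τ
    row≤height {a} c∈τ = ≤-trans (∈τ⇒≤conj c∈τ) (length-filter (a ≤?_) τ)

    arm≤width : ∀ {c} → c ∈τ τ → arm τ c ≤ part τ 1
    arm≤width {i , j} c∈τ = ≤-trans (m∸n≤m (part τ j) i) (column≤width (rowEnd∈τ c∈τ))

    leg≤height : ∀ {c} → c ∈τ τ → leg τ c ≤ length τ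
    leg≤height {i , j} c∈τ = ≤-trans (m∸n≤m (conj τ i) j) (row≤height (columnTop∈τ c∈τ))

module LinearForms where

  open import Data.Nat
  open import Data.Nat.Properties
  open import Data.Nat.Tactic.RingSolver using (solve)
  open import Data.List using (List; []; _∷_)
  open import Data.Product using (_×_; _,_; proj₁; proj₂)
  open import Data.Sum using (_⊎_; inj₁; inj₂)
  open import Relation.Binary.PropositionalEquality
  open import Function using (_∘_)
  open ≤-Reasoning

  form : ℕ → ℕ → Cell → ℕ
  form p q (a , b) = p * a + q * b

  Maximises : List ℕ → (Cell → ℕ) → Cell → Set
  Maximises τ f c = c ∈τ τ × (∀ {d} → d ∈τ τ → f d ≤ f c)

  LexMaximises : List ℕ → (Cell → ℕ) → (Cell → ℕ) → Cell → Set
  LexMaximises τ f g c = Maximises τ f c × (∀ {d} → d ∈τ τ → f d ≡ f c → g d ≤ g c)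

  lexicographic-< : ∀ {N f f′ g g′} → g < N → f < f′ ⊎ (f ≡ f′ × g < g′) → N * f + g < N * f′ + g′
  lexicographic-< {N} {f} {f′} {g} {g′} g<N (inj₁ f<f′) = begin-strict
    N * f + g     <⟨ +-monoʳ-< (N * f) g<N ⟩
    N * f + N     ≡⟨ solve (N ∷ f ∷ []) ⟩
    N * suc f     ≤⟨ *-monoʳ-≤ N f<f′ ⟩
    N * f′        ≤⟨ m≤m+n (N * f′) g′ ⟩
    N * f′ + g′   ∎
  lexicographic-< {N} g<N (inj₂ (refl , g<g′)) = +-monoʳ-< (N * _) g<g′

  perturbed-form₁ : ∀ N p q c → form (N * p + 1) (N * q) c ≡ N * form p q c + proj₁ c
  perturbed-form₁ N p q (a , b) = identity
    where
    identity : (N * p + 1) * a + N * q * b ≡ N * (p * a + q * b) + a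
    identity = solve (N ∷ p ∷ q ∷ a ∷ b ∷ [])

  perturbed-form₂ : ∀ N p q c → form (N * p) (N * q + 1) c ≡ N * form p q c + proj₂ c
  perturbed-form₂ N p q (a , b) = identity
    where
    identity : N * p * a + (N * q + 1) * b ≡ N * (p * a + q * b) + b
    identity = solve (N ∷ p ∷ q ∷ a ∷ b ∷ [])

  form-columnInjective : ∀ p q {d c} → form p (suc q) d ≡ form p (suc q) c → proj₁ d ≡ proj₁ c → d ≡ c
  form-columnInjective p q {a , b} {.a , b′} same-level refl =
    cong (a ,_) (*-cancelˡ-≡ b b′ (suc q) (+-cancelˡ-≡ (p * a) _ _ same-level))

  form-rowInjective : ∀ p q {d c} → form (suc p) q d ≡ form (suc p) q c → proj₂ d ≡ proj₂ c → d ≡ c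
  form-rowInjective p q {a , b} {a′ , .b} same-level refl =
    cong (_, b) (*-cancelˡ-≡ a a′ (suc p) (+-cancelʳ-≡ (q * b) (suc p * a) (suc p * a′) same-level))

  form-northEast-< : ∀ p q {a b a′ b′} → a ≤ a′ → b < b′ → form p (suc q) (a , b) < form p (suc q) (a′ , b′)
  form-northEast-< p q a≤a′ b<b′ = +-mono-≤-< (*-monoʳ-≤ p a≤a′) (*-monoʳ-< (suc q) b<b′)

  form-hookEnds⁻ : ∀ α β i j → form β (suc α) (i , j + β) ≡ form β (suc α) (i + suc α , j)
  form-hookEnds⁻ α β i j = identity
    where
    identity : β * i + suc α * (j + β) ≡ β * (i + suc α) + suc α * j
    identity = solve (α ∷ β ∷ i ∷ j ∷ [])

  form-hookEnds⁺ : ∀ α β i j → form (suc β) α (i + α , j) ≡ form (suc β) α (i , j + suc β)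
  form-hookEnds⁺ α β i j = identity
    where
    identity : suc β * (i + α) + α * j ≡ suc β * i + α * (j + suc β)
    identity = solve (α ∷ β ∷ i ∷ j ∷ [])

  perturb-exact : ∀ N x y → N * suc x * y < (N * y + 1) * suc x
  perturb-exact N x y = begin-strict
    N * suc x * y           <⟨ m<m+n (N * suc x * y) (s≤s z≤n) ⟩
    N * suc x * y + suc x   ≡⟨ solve (N ∷ x ∷ y ∷ []) ⟩
    (N * y + 1) * suc x     ∎

  perturb-gap : ∀ N x y {z} → x * y < z → y < N → (N * x + 1) * y < N * z
  perturb-gap N x y {z} xy<z y<N = begin-strict
    (N * x + 1) * y     ≡⟨ solve (N ∷ x ∷ y ∷ []) ⟩
    N * (x * y) + y     <⟨ +-monoʳ-< (N * (x * y)) y<N ⟩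
    N * (x * y) + N     ≡⟨ solve (N ∷ x ∷ y ∷ []) ⟩
    N * suc (x * y)     ≤⟨ *-monoʳ-≤ N xy<z ⟩
    N * z               ∎

  complement-≤ : ∀ {m k m′ k′ D D′} → D ≡ m + k → D′ ≡ m′ + k′ → m * D′ ≤ m′ * D → k′ * (m + k) ≤ k * (m′ + k′)
  complement-≤ {m} {k} {m′} {k′} refl refl mD′≤m′D = begin
    k′ * (m + k)     ≡⟨ solve (m ∷ k ∷ m′ ∷ k′ ∷ []) ⟩
    m * k′ + k * k′  ≤⟨ +-monoˡ-≤ (k * k′) mk′≤m′k ⟩
    m′ * k + k * k′  ≡⟨ solve (m ∷ k ∷ m′ ∷ k′ ∷ []) ⟩
    k * (m′ + k′)    ∎
    where
    mk′≤m′k : m * k′ ≤ m′ * k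
    mk′≤m′k = +-cancelˡ-≤ (m * m′) _ _ (subst₂ _≤_ expandˡ expandʳ mD′≤m′D)
      where
      expandˡ : m * (m′ + k′) ≡ m * m′ + m * k′
      expandˡ = solve (m ∷ m′ ∷ k′ ∷ [])
      expandʳ : m′ * (m + k) ≡ m * m′ + m′ * k
      expandʳ = solve (m ∷ k ∷ m′ ∷ [])

  lexMaximiser-strict : ∀ {τ} f g {c} N → LexMaximises τ f g c → (∀ {d} → d ∈τ τ → g d < N) →
                        (∀ {d} → f d ≡ f c → g d ≡ g c → d ≡ c) →
                        ∀ {d} → d ∈τ τ → d ≢ c → N * f d + g d < N * f c + g c
  lexMaximiser-strict f g {c} N ((_ , f≤) , tie≤) g<N line-injective {d} d∈τ d≢c
    with m≤n⇒m<n∨m≡n (f≤ d∈τ)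
  ... | inj₁ fd<fc = lexicographic-< (g<N d∈τ) (inj₁ fd<fc)
  ... | inj₂ fd≡fc = lexicographic-< (g<N d∈τ) (inj₂ (fd≡fc , ≤∧≢⇒< (tie≤ d∈τ fd≡fc) (d≢c ∘ line-injective fd≡fc)))

module Cuts where

  open Embedding
  open LinearForms using (form)
  open import Data.Nat as ℕ using (ℕ; suc)
  import Data.Nat.Properties as ℕP
  open import Data.Rational
    using (ℚ; 0ℚ; 1ℚ; _<_; _≤_; _+_; _*_; _-_; _÷_; 1/_; positive; nonNegative; >-nonZero; NonZero)
  open import Data.Rational.Properties
  open import Data.Rational.Solver using (module +-*-Solver)
  open +-*-Solver using (solve; _:+_; _:*_; _:-_; _:=_)
  open import Data.Product using (Σ; _×_; _,_; proj₁; proj₂)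
  open import Data.Sum using (_⊎_)
  open import Relation.Binary.PropositionalEquality
  open import Relation.Nullary using (¬_)

  level : ℚ → ℚ → Cell → ℚ
  level u v (a , b) = ⟦ a ⟧ * u + ⟦ b ⟧ * v

  level-swap : ∀ u v a b → level v u (b , a) ≡ level u v (a , b)
  level-swap u v a b = +-comm (⟦ b ⟧ * v) (⟦ a ⟧ * u)

  CutBy : (Cell → Set) → ℚ → ℚ → ℚ → Set
  CutBy S u v M = ∀ a b → (S (a , b) → 1 ℕ.≤ a × 1 ℕ.≤ b × level u v (a , b) ≤ M)
                        × (1 ℕ.≤ a × 1 ℕ.≤ b × level u v (a , b) ≤ M → S (a , b))

  LinearCut : (Cell → Set) → Set
  LinearCut S = Σ ℚ λ u → Σ ℚ λ v → 0ℚ < u × 0ℚ < v × CutBy S u v 1ℚ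

  level-⟦⟧ : ∀ u v c → level ⟦ u ⟧ ⟦ v ⟧ c ≡ ⟦ form u v c ⟧
  level-⟦⟧ u v (a , b) = sym (begin
    ⟦ u ℕ.* a ℕ.+ v ℕ.* b ⟧           ≡⟨ ⟦⟧-+ (u ℕ.* a) (v ℕ.* b) ⟩
    ⟦ u ℕ.* a ⟧ + ⟦ v ℕ.* b ⟧         ≡⟨ cong₂ _+_ (⟦⟧-* u a) (⟦⟧-* v b) ⟩
    ⟦ u ⟧ * ⟦ a ⟧ + ⟦ v ⟧ * ⟦ b ⟧     ≡⟨ cong₂ _+_ (*-comm ⟦ u ⟧ ⟦ a ⟧) (*-comm ⟦ v ⟧ ⟦ b ⟧) ⟩
    ⟦ a ⟧ * ⟦ u ⟧ + ⟦ b ⟧ * ⟦ v ⟧     ∎)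
    where open ≡-Reasoning

  cut-separates : ∀ {S u v M} → CutBy S u v M → ∀ x y → S x → ¬ S y → 1 ℕ.≤ proj₁ y → 1 ℕ.≤ proj₂ y →
                  level u v x < level u v y
  cut-separates cut (x , y) (a , b) x∈S ab∉S 1≤a 1≤b =
    ≰⇒> λ ab≤x → ab∉S (proj₂ (cut _ _) (1≤a , 1≤b , ≤-trans ab≤x (proj₂ (proj₂ (proj₁ (cut x y) x∈S)))))

  1/-pos : ∀ r → (r>0 : 0ℚ < r) → 0ℚ < (1/ r) {{>-nonZero r>0}}
  1/-pos r r>0 = positive⁻¹ _ {{1/pos⇒pos r {{positive r>0}}}}

  triangular⇒cut : ∀ {S} → IsTriangular S → LinearCut S
  triangular⇒cut (r , s , r>0 , s>0 , tri) =
    (1/ r) {{>-nonZero r>0}} , (1/ s) {{>-nonZero s>0}} , 1/-pos r r>0 , 1/-pos s s>0 , tri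

  cut⇒triangular : ∀ {S u v M} → 0ℚ < u → 0ℚ < v → 0ℚ < M → CutBy S u v M → IsTriangular S
  cut⇒triangular {S} {u} {v} {M} u>0 v>0 M>0 cut = r , s , r>0 , s>0 , λ a b → to a b , from a b
    where
    instance
      M≢0 : NonZero M
      M≢0 = >-nonZero M>0
    M⁻¹>0 : 0ℚ < 1/ M
    M⁻¹>0 = 1/-pos M M>0
    u′>0 : 0ℚ < u * 1/ M
    u′>0 = *-pos u>0 M⁻¹>0
    v′>0 : 0ℚ < v * 1/ M
    v′>0 = *-pos v>0 M⁻¹>0
    r s : ℚ
    r = (1/ (u * 1/ M)) {{>-nonZero u′>0}}
    s = (1/ (v * 1/ M)) {{>-nonZero v′>0}}
    r>0 : 0ℚ < r
    r>0 = 1/-pos _ u′>0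
    s>0 : 0ℚ < s
    s>0 = 1/-pos _ v′>0
    scaled : ∀ a b → _÷_ ⟦ a ⟧ r {{>-nonZero r>0}} + _÷_ ⟦ b ⟧ s {{>-nonZero s>0}} ≡ level u v (a , b) * 1/ M
    scaled a b = begin
      _÷_ ⟦ a ⟧ r {{>-nonZero r>0}} + _÷_ ⟦ b ⟧ s {{>-nonZero s>0}}
        ≡⟨ cong₂ (λ x y → ⟦ a ⟧ * x + ⟦ b ⟧ * y) (1/-involutive _ {{>-nonZero u′>0}}) (1/-involutive _ {{>-nonZero v′>0}}) ⟩
      ⟦ a ⟧ * (u * 1/ M) + ⟦ b ⟧ * (v * 1/ M)
        ≡⟨ solve 5 (λ a b u v i → a :* (u :* i) :+ b :* (v :* i) := (a :* u :+ b :* v) :* i) refl ⟦ a ⟧ ⟦ b ⟧ u v (1/ M) ⟩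
      level u v (a , b) * 1/ M ∎
      where open ≡-Reasoning
    ≤M⇒scaled≤1 : ∀ {x} → x ≤ M → x * 1/ M ≤ 1ℚ
    ≤M⇒scaled≤1 {x} x≤M = subst (x * 1/ M ≤_) (*-inverseʳ M) (*-monoʳ-≤-nonNeg (1/ M) {{nonNegative (<⇒≤ M⁻¹>0)}} x≤M)
    scaled≤1⇒≤M : ∀ {x} → x * 1/ M ≤ 1ℚ → x ≤ M
    scaled≤1⇒≤M {x} x/M≤1 = *-cancelʳ-≤-pos (1/ M) {{positive M⁻¹>0}} (subst (x * 1/ M ≤_) (sym (*-inverseʳ M)) x/M≤1)
    UnderLine : ℕ → ℕ → Set
    UnderLine a b = 1 ℕ.≤ a × 1 ℕ.≤ b × _÷_ ⟦ a ⟧ r {{>-nonZero r>0}} + _÷_ ⟦ b ⟧ s {{>-nonZero s>0}} ≤ 1ℚ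
    to : ∀ a b → S (a , b) → UnderLine a b
    to a b ab∈S = let (1≤a , 1≤b , ab≤M) = proj₁ (cut a b) ab∈S in
      1≤a , 1≤b , subst (_≤ 1ℚ) (sym (scaled a b)) (≤M⇒scaled≤1 ab≤M)
    from : ∀ a b → UnderLine a b → S (a , b)
    from a b (1≤a , 1≤b , ab≤1) = proj₂ (cut a b) (1≤a , 1≤b , scaled≤1⇒≤M (subst (_≤ 1ℚ) (scaled a b) ab≤1))

  form-≤⇒level-≤ : ∀ {u v} α β x y → 0ℚ ≤ v → form β (suc α) y ℕ.≤ form β (suc α) x →
         (⟦ β ⟧ * v ≤ ⟦ suc α ⟧ * u × proj₁ y ℕ.≤ proj₁ x) ⊎ (⟦ suc α ⟧ * u ≤ ⟦ β ⟧ * v × proj₁ x ℕ.≤ proj₁ y) →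
         level u v y ≤ level u v x
  form-≤⇒level-≤ {u} {v} α β (x₁ , x₂) (y₁ , y₂) 0≤v Fy≤Fx same-sign =
    0≤q-p⇒p≤q (*-cancelˡ-≤-pos A {{positive (⟦suc⟧-pos α)}}
      (subst₂ _≤_ (sym (*-zeroʳ A)) identity (+-nonNeg (same-sign⇒0≤* same-sign) (*-nonNeg 0≤v (p≤q⇒0≤q-p F≤)))))
    where
    A B : ℚ
    A = ⟦ suc α ⟧
    B = ⟦ β ⟧
    ⟦form⟧ : ∀ a b → ⟦ form β (suc α) (a , b) ⟧ ≡ B * ⟦ a ⟧ + A * ⟦ b ⟧
    ⟦form⟧ a b = trans (⟦⟧-+ (β ℕ.* a) (suc α ℕ.* b)) (cong₂ _+_ (⟦⟧-* β a) (⟦⟧-* (suc α) b))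
    F≤ : B * ⟦ y₁ ⟧ + A * ⟦ y₂ ⟧ ≤ B * ⟦ x₁ ⟧ + A * ⟦ x₂ ⟧
    F≤ = subst₂ _≤_ (⟦form⟧ y₁ y₂) (⟦form⟧ x₁ x₂) (⟦⟧-mono-≤ Fy≤Fx)
    identity : (A * u - B * v) * (⟦ x₁ ⟧ - ⟦ y₁ ⟧) + v * ((B * ⟦ x₁ ⟧ + A * ⟦ x₂ ⟧) - (B * ⟦ y₁ ⟧ + A * ⟦ y₂ ⟧))
               ≡ A * (level u v (x₁ , x₂) - level u v (y₁ , y₂))
    identity = solve 8 (λ A B u v x₁ x₂ y₁ y₂ →
                 (A :* u :- B :* v) :* (x₁ :- y₁) :+ v :* ((B :* x₁ :+ A :* x₂) :- (B :* y₁ :+ A :* y₂))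
                 := A :* ((x₁ :* u :+ x₂ :* v) :- (y₁ :* u :+ y₂ :* v)))
                 refl A B u v ⟦ x₁ ⟧ ⟦ x₂ ⟧ ⟦ y₁ ⟧ ⟦ y₂ ⟧

  form-≤⇒level-≤′ : ∀ {u v} α β x y → 0ℚ ≤ u → form (suc β) α y ℕ.≤ form (suc β) α x →
          (⟦ α ⟧ * u ≤ ⟦ suc β ⟧ * v × proj₂ y ℕ.≤ proj₂ x) ⊎ (⟦ suc β ⟧ * v ≤ ⟦ α ⟧ * u × proj₂ x ℕ.≤ proj₂ y) →
          level u v y ≤ level u v x
  form-≤⇒level-≤′ {u} {v} α β (x₁ , x₂) (y₁ , y₂) 0≤u Fy≤Fx same-sign =
    subst₂ _≤_ (level-swap u v y₁ y₂) (level-swap u v x₁ x₂)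
      (form-≤⇒level-≤ β α (x₂ , x₁) (y₂ , y₁) 0≤u
        (subst₂ ℕ._≤_ (ℕP.+-comm (suc β ℕ.* y₁) (α ℕ.* y₂)) (ℕP.+-comm (suc β ℕ.* x₁) (α ℕ.* x₂)) Fy≤Fx) same-sign)

module Hooks where

  open Embedding
  open YoungDiagram
  open LinearForms using (form; form-hookEnds⁻; form-hookEnds⁺)
  open Cuts
  open import Data.Nat as ℕ using (ℕ; suc; z≤n; s≤s)
  import Data.Nat.Properties as ℕP
  open import Data.List using (List)
  open import Data.Rational using (ℚ; 0ℚ; _<_; _≤_; _+_; _*_; _-_; positive; nonNegative)
  open import Data.Rational.Properties
  open import Data.Rational.Solver using (module +-*-Solver)
  open +-*-Solver using (solve; _:+_; _:*_; _:-_; con; _:=_)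
  open import Data.Product using (_×_; _,_; proj₁; proj₂)
  open import Relation.Binary.PropositionalEquality
  open import Relation.Nullary using (¬_; Dec; yes; no)
  open import Data.Empty using (⊥-elim)

  -- level (0 , β) < level (α + 1 , 0): the top of a leg lies below the first cell past the arm.
  HookBound : ℚ → ℚ → ℕ → ℕ → Set
  HookBound u v α β = ⟦ β ⟧ * v < ⟦ suc α ⟧ * u

  HookSeparated : List ℕ → ℚ → ℚ → Set
  HookSeparated τ u v = ∀ {c} → c ∈τ τ → HookBound u v (arm τ c) (leg τ c) × HookBound v u (leg τ c) (arm τ c)

  level-shift-< : ∀ {u v} a b x y → level u v (a , b ℕ.+ y) < level u v (a ℕ.+ x , b) → ⟦ y ⟧ * v < ⟦ x ⟧ * u
  level-shift-< {u} {v} a b x y shifted = 0<q-p⇒p<q (subst (0ℚ <_) difference (p<q⇒0<q-p expanded))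
    where
    expanded : ⟦ a ⟧ * u + (⟦ b ⟧ + ⟦ y ⟧) * v < (⟦ a ⟧ + ⟦ x ⟧) * u + ⟦ b ⟧ * v
    expanded = subst₂ (λ b+y a+x → ⟦ a ⟧ * u + b+y * v < a+x * u + ⟦ b ⟧ * v) (⟦⟧-+ b y) (⟦⟧-+ a x) shifted
    difference : (⟦ a ⟧ + ⟦ x ⟧) * u + ⟦ b ⟧ * v - (⟦ a ⟧ * u + (⟦ b ⟧ + ⟦ y ⟧) * v) ≡ ⟦ x ⟧ * u - ⟦ y ⟧ * v
    difference = solve 6 (λ a b x y u v → (a :+ x) :* u :+ b :* v :- (a :* u :+ (b :+ y) :* v) := x :* u :- y :* v)
                   refl ⟦ a ⟧ ⟦ b ⟧ ⟦ x ⟧ ⟦ y ⟧ u v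

  hookBound⇒level-< : ∀ {u v α β a b a′ b′} → 0ℚ ≤ u → 0ℚ ≤ v → HookBound u v α β →
                      a ℕ.+ suc α ℕ.≤ a′ → b ℕ.≤ b′ ℕ.+ β → level u v (a , b) < level u v (a′ , b′)
  hookBound⇒level-< {u} {v} {α} {β} {a} {b} {a′} {b′} 0≤u 0≤v bound a+α<a′ b≤b′+β = begin-strict
    ⟦ a ⟧ * u + ⟦ b ⟧ * v
      ≤⟨ +-monoʳ-≤ (⟦ a ⟧ * u) (*-monoʳ-≤-nonNeg v {{nonNegative 0≤v}} (⟦⟧-mono-≤ b≤b′+β)) ⟩
    ⟦ a ⟧ * u + ⟦ b′ ℕ.+ β ⟧ * v
      ≡⟨ cong (λ z → ⟦ a ⟧ * u + z * v) (⟦⟧-+ b′ β) ⟩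
    ⟦ a ⟧ * u + (⟦ b′ ⟧ + ⟦ β ⟧) * v
      ≡⟨ solve 5 (λ a b′ β u v → a :* u :+ (b′ :+ β) :* v := a :* u :+ b′ :* v :+ β :* v) refl ⟦ a ⟧ ⟦ b′ ⟧ ⟦ β ⟧ u v ⟩
    ⟦ a ⟧ * u + ⟦ b′ ⟧ * v + ⟦ β ⟧ * v
      <⟨ +-monoʳ-< (⟦ a ⟧ * u + ⟦ b′ ⟧ * v) bound ⟩
    ⟦ a ⟧ * u + ⟦ b′ ⟧ * v + ⟦ suc α ⟧ * u
      ≡⟨ solve 5 (λ a b′ A u v → a :* u :+ b′ :* v :+ A :* u := (a :+ A) :* u :+ b′ :* v) refl ⟦ a ⟧ ⟦ b′ ⟧ ⟦ suc α ⟧ u v ⟩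
    (⟦ a ⟧ + ⟦ suc α ⟧) * u + ⟦ b′ ⟧ * v
      ≡⟨ cong (λ z → z * u + ⟦ b′ ⟧ * v) (⟦⟧-+ a (suc α)) ⟨
    ⟦ a ℕ.+ suc α ⟧ * u + ⟦ b′ ⟧ * v
      ≤⟨ +-monoˡ-≤ (⟦ b′ ⟧ * v) (*-monoʳ-≤-nonNeg u {{nonNegative 0≤u}} (⟦⟧-mono-≤ a+α<a′)) ⟩
    ⟦ a′ ⟧ * u + ⟦ b′ ⟧ * v ∎
    where open ≤-Reasoning

  hookBound⇒level-<′ : ∀ {u v α β a b a′ b′} → 0ℚ ≤ u → 0ℚ ≤ v → HookBound v u β α →
                       b ℕ.+ suc β ℕ.≤ b′ → a ℕ.≤ a′ ℕ.+ α → level u v (a , b) < level u v (a′ , b′)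
  hookBound⇒level-<′ {u} {v} {α} {β} {a} {b} {a′} {b′} 0≤u 0≤v bound b+β<b′ a≤a′+α =
    subst₂ _<_ (level-swap u v a b) (level-swap u v a′ b′)
      (hookBound⇒level-< {v} {u} {β} {α} {b} {a} {b′} {a′} 0≤v 0≤u bound b+β<b′ a≤a′+α)

  hookBound-transfer : ∀ {u v α β α′ β′} → 0ℚ ≤ v → β′ ℕ.* suc (α ℕ.+ β) ℕ.≤ β ℕ.* suc (α′ ℕ.+ β′) →
                       HookBound u v α β → HookBound u v α′ β′
  hookBound-transfer {u} {v} {α} {β} {α′} {β′} 0≤v ratio≤ bound = ≰⇒> λ A′u≤B′v → pos+nonNeg+nonNeg≢0
    (*-pos (⟦suc⟧-pos α′) (p<q⇒0<q-p bound))
    (*-nonNeg 0≤v (p≤q⇒0≤q-p ratio≤′))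
    (*-nonNeg (⟦⟧-nonNeg (suc α)) (p≤q⇒0≤q-p A′u≤B′v))
    (solve 6 (λ u v A B A′ B′ → A′ :* (A :* u :- B :* v) :+ v :* (B :* (A′ :+ B′) :- B′ :* (A :+ B))
                                :+ A :* (B′ :* v :- A′ :* u) := con 0ℚ)
       refl u v ⟦ suc α ⟧ ⟦ β ⟧ ⟦ suc α′ ⟧ ⟦ β′ ⟧)
    where
    ⟦hook⟧ : ∀ α β → ⟦ suc (α ℕ.+ β) ⟧ ≡ ⟦ suc α ⟧ + ⟦ β ⟧
    ⟦hook⟧ α β = ⟦⟧-+ (suc α) β
    ratio≤′ : ⟦ β′ ⟧ * (⟦ suc α ⟧ + ⟦ β ⟧) ≤ ⟦ β ⟧ * (⟦ suc α′ ⟧ + ⟦ β′ ⟧)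
    ratio≤′ = subst₂ _≤_ (trans (⟦⟧-* β′ _) (cong (⟦ β′ ⟧ *_) (⟦hook⟧ α β)))
                         (trans (⟦⟧-* β _) (cong (⟦ β ⟧ *_) (⟦hook⟧ α′ β′))) (⟦⟧-mono-≤ ratio≤)

  hookBounds⇒lowerRatio<upperRatio : ∀ {u v α β α′ β′} → 0ℚ < u → 0ℚ < v →
                                     HookBound u v α β → HookBound v u β′ α′ → β ℕ.* α′ ℕ.< suc α ℕ.* suc β′
  hookBounds⇒lowerRatio<upperRatio {u} {v} {α} {β} {α′} {β′} 0<u 0<v bound bound′ =
    ⟦⟧-cancel-< (subst₂ _<_ (sym (⟦⟧-* β α′)) (sym (⟦⟧-* (suc α) (suc β′))) (≰⇒> λ AP≤BQ → pos+nonNeg+nonNeg≢0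
      (*-pos (p<q⇒0<q-p bound) (*-pos (⟦suc⟧-pos β′) 0<v))
      (*-nonNeg (*-nonNeg (⟦⟧-nonNeg β) (<⇒≤ 0<v)) (<⇒≤ (p<q⇒0<q-p bound′)))
      (*-nonNeg (<⇒≤ (*-pos 0<u 0<v)) (p≤q⇒0≤q-p AP≤BQ))
      (solve 6 (λ u v A B P Q → (A :* u :- B :* v) :* (P :* v) :+ (B :* v) :* (P :* v :- Q :* u)
                                :+ (u :* v) :* (B :* Q :- A :* P) := con 0ℚ)
         refl u v ⟦ suc α ⟧ ⟦ β ⟧ ⟦ suc β′ ⟧ ⟦ α′ ⟧)))

  module _ {τ : List ℕ} (↓ : Decreasing τ) where

    cut⇒hookSeparated : ∀ {u v M} → CutBy (_∈τ τ) u v M → HookSeparated τ u v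
    cut⇒hookSeparated {u} {v} cut {i , j} c∈τ = lower , upper
      where
      α β : ℕ
      α = arm τ (i , j)
      β = leg τ (i , j)
      columnTop≡ : conj τ i ≡ j ℕ.+ β
      columnTop≡ = sym (row+leg≡conj ↓ c∈τ)
      rowEnd≡ : part τ j ≡ i ℕ.+ α
      rowEnd≡ = sym (column+arm≡part ↓ c∈τ)
      lower : HookBound u v α β
      lower = level-shift-< i j (suc α) β (subst₂ (λ top past → level u v (i , top) < level u v (past , j))
        columnTop≡ (trans (cong suc rowEnd≡) (sym (ℕP.+-suc i α)))
        (cut-separates cut (i , conj τ i) (suc (part τ j) , j) (columnTop∈τ ↓ c∈τ) (pastRowEnd∉τ ↓ j)
                       (s≤s z≤n) (proj₁ (proj₂ c∈τ))))
      upper : HookBound v u β α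
      upper = level-shift-< j i (suc β) α (subst₂ (λ end past → level v u (j , end) < level v u (past , i))
        rowEnd≡ (trans (cong suc columnTop≡) (sym (ℕP.+-suc j β)))
        (subst₂ _<_ (sym (level-swap u v (part τ j) j)) (sym (level-swap u v i (suc (conj τ i))))
          (cut-separates cut (part τ j , j) (i , suc (conj τ i)) (rowEnd∈τ ↓ c∈τ) (pastColumnTop∉τ ↓ i)
                         (proj₁ c∈τ) (s≤s z≤n))))

    form-columnTop≡form-pastRowEnd : ∀ {i j} → (i , j) ∈τ τ →
      let α = arm τ (i , j) ; β = leg τ (i , j) in form β (suc α) (i , conj τ i) ≡ form β (suc α) (suc (part τ j) , j)
    form-columnTop≡form-pastRowEnd {i} {j} c∈τ = begin
      form β (suc α) (i , conj τ i)          ≡⟨ cong (λ top → form β (suc α) (i , top)) (sym (row+leg≡conj ↓ c∈τ)) ⟩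
      form β (suc α) (i , j ℕ.+ β)           ≡⟨ form-hookEnds⁻ α β i j ⟩
      form β (suc α) (i ℕ.+ suc α , j)       ≡⟨ cong (λ past → form β (suc α) (past , j))
                                                   (trans (ℕP.+-suc i α) (cong suc (column+arm≡part ↓ c∈τ))) ⟩
      form β (suc α) (suc (part τ j) , j)    ∎
      where
      open ≡-Reasoning
      α β : ℕ
      α = arm τ (i , j)
      β = leg τ (i , j)

    form-rowEnd≡form-pastColumnTop : ∀ {i j} → (i , j) ∈τ τ →
      let α = arm τ (i , j) ; β = leg τ (i , j) in form (suc β) α (part τ j , j) ≡ form (suc β) α (i , suc (conj τ i))
    form-rowEnd≡form-pastColumnTop {i} {j} c∈τ = begin
      form (suc β) α (part τ j , j)          ≡⟨ cong (λ end → form (suc β) α (end , j)) (sym (column+arm≡part ↓ c∈τ)) ⟩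
      form (suc β) α (i ℕ.+ α , j)           ≡⟨ form-hookEnds⁺ α β i j ⟩
      form (suc β) α (i , j ℕ.+ suc β)       ≡⟨ cong (λ past → form (suc β) α (i , past))
                                                   (trans (ℕP.+-suc j β) (cong suc (row+leg≡conj ↓ c∈τ))) ⟩
      form (suc β) α (i , suc (conj τ i))    ∎
      where
      open ≡-Reasoning
      α β : ℕ
      α = arm τ (i , j)
      β = leg τ (i , j)

    inside<outside : ∀ {u v a b a′ b′} → HookSeparated τ u v → 0ℚ < u → 0ℚ < v → (a , b) ∈τ τ →
                     1 ℕ.≤ a′ → 1 ℕ.≤ b′ → ¬ (a′ , b′) ∈τ τ → level u v (a , b) < level u v (a′ , b′)
    inside<outside {u} {v} {a} {b} {a′} {b′} sep 0<u 0<v ab∈τ@(1≤a , 1≤b , a≤part) 1≤a′ 1≤b′ a′b′∉τ =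
      by-position (a ℕ.<? a′) (b′ ℕ.<? b)
      where
      by-position : Dec (a ℕ.< a′) → Dec (b′ ℕ.< b) → level u v (a , b) < level u v (a′ , b′)
      by-position (no a≮a′) _ =
        hookBound⇒level-<′ {α = arm τ c} {leg τ c} (<⇒≤ 0<u) (<⇒≤ 0<v) (proj₂ (sep c∈τ)) b+β<b′ a≤a′+α
        where
        c : Cell
        c = (a′ , b)
        c∈τ : c ∈τ τ
        c∈τ = ∈τ-downClosed ↓ ab∈τ 1≤a′ 1≤b (ℕP.≮⇒≥ a≮a′) ℕP.≤-refl
        a≤a′+α : a ℕ.≤ a′ ℕ.+ arm τ c
        a≤a′+α = subst (a ℕ.≤_) (sym (column+arm≡part ↓ c∈τ)) a≤part
        b+β<b′ : b ℕ.+ suc (leg τ c) ℕ.≤ b′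
        b+β<b′ = subst (ℕ._≤ b′) (trans (cong suc (sym (row+leg≡conj ↓ c∈τ))) (sym (ℕP.+-suc b (leg τ c))))
                   (ℕP.≰⇒> λ b′≤conj → a′b′∉τ (1≤a′ , 1≤b′ , ≤conj⇒≤part ↓ 1≤a′ 1≤b′ b′≤conj))
      by-position (yes a<a′) (yes b′<b) =
        hookBound⇒level-< {α = arm τ c} {leg τ c} (<⇒≤ 0<u) (<⇒≤ 0<v) (proj₁ (sep c∈τ)) a+α<a′ b≤b′+β
        where
        c : Cell
        c = (a , b′)
        c∈τ : c ∈τ τ
        c∈τ = ∈τ-downClosed ↓ ab∈τ 1≤a 1≤b′ ℕP.≤-refl (ℕP.<⇒≤ b′<b)
        a+α<a′ : a ℕ.+ suc (arm τ c) ℕ.≤ a′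
        a+α<a′ = subst (ℕ._≤ a′) (trans (cong suc (sym (column+arm≡part ↓ c∈τ))) (sym (ℕP.+-suc a (arm τ c))))
                   (ℕP.≰⇒> λ a′≤part → a′b′∉τ (1≤a′ , 1≤b′ , a′≤part))
        b≤b′+β : b ℕ.≤ b′ ℕ.+ leg τ c
        b≤b′+β = subst (b ℕ.≤_) (sym (row+leg≡conj ↓ c∈τ)) (∈τ⇒≤conj ↓ ab∈τ)
      by-position (yes a<a′) (no b′≮b) = +-mono-<-≤ (*-monoˡ-<-pos u {{positive 0<u}} (⟦⟧-mono-< a<a′))
                                                    (*-monoʳ-≤-nonNeg v {{nonNegative (<⇒≤ 0<v)}} (⟦⟧-mono-≤ (ℕP.≮⇒≥ b′≮b)))

    removable-of-strict-max : ∀ {u v c} → 1 ℕ.≤ u → 1 ℕ.≤ v → HookSeparated τ ⟦ u ⟧ ⟦ v ⟧ → c ∈τ τ →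
                              (∀ {d} → d ∈τ τ → d ≢ c → form u v d ℕ.< form u v c) → Removable τ c
    removable-of-strict-max {u} {v} {c₁ , c₂} 1≤u 1≤v sep c∈τ@(1≤c₁ , 1≤c₂ , _) below-c =
      c∈τ , cut⇒triangular (⟦⟧-pos 1≤u) (⟦⟧-pos 1≤v) (⟦⟧-pos {M} 1≤M) cut
      where
      c : Cell
      c = (c₁ , c₂)
      M : ℕ
      M = ℕ.pred (form u v c)
      2≤form : 2 ℕ.≤ form u v c
      2≤form = ℕP.+-mono-≤ (ℕP.*-mono-≤ 1≤u 1≤c₁) (ℕP.*-mono-≤ 1≤v 1≤c₂)
      1≤M : 1 ℕ.≤ M
      1≤M = ℕP.pred-mono-≤ 2≤form
      ≤M⇒<form : ∀ {n} → n ℕ.≤ M → n ℕ.< form u v c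
      ≤M⇒<form = ℕP.m≤pred[n]⇒suc[m]≤n {{ℕ.>-nonZero (ℕP.<-≤-trans (s≤s z≤n) 2≤form)}}
      cut : CutBy (λ d → d ∈τ τ × d ≢ c) ⟦ u ⟧ ⟦ v ⟧ ⟦ M ⟧
      cut a b = to , from
        where
        to : (a , b) ∈τ τ × (a , b) ≢ c → 1 ℕ.≤ a × 1 ℕ.≤ b × level ⟦ u ⟧ ⟦ v ⟧ (a , b) ≤ ⟦ M ⟧
        to (ab∈τ , ab≢c) = proj₁ ab∈τ , proj₁ (proj₂ ab∈τ) ,
          subst (_≤ ⟦ M ⟧) (sym (level-⟦⟧ u v (a , b))) (⟦⟧-mono-≤ (ℕP.suc[m]≤n⇒m≤pred[n] (below-c ab∈τ ab≢c)))
        from : 1 ℕ.≤ a × 1 ℕ.≤ b × level ⟦ u ⟧ ⟦ v ⟧ (a , b) ≤ ⟦ M ⟧ → (a , b) ∈τ τ × (a , b) ≢ c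
        from (1≤a , 1≤b , ab≤M) = ab∈τ , λ { refl → ℕP.n≮n _ ab<c }
          where
          ab<c : form u v (a , b) ℕ.< form u v c
          ab<c = ≤M⇒<form (⟦⟧-cancel-≤ (subst (_≤ ⟦ M ⟧) (level-⟦⟧ u v (a , b)) ab≤M))
          ab∈τ : (a , b) ∈τ τ
          ab∈τ = decided ((a , b) ∈τ? τ)
            where
            decided : Dec ((a , b) ∈τ τ) → (a , b) ∈τ τ
            decided (yes ab∈τ) = ab∈τ
            decided (no ab∉τ) = ⊥-elim (ℕP.<-asym ab<c (⟦⟧-cancel-< (subst₂ _<_ (level-⟦⟧ u v c) (level-⟦⟧ u v (a , b))
                            (inside<outside sep (⟦⟧-pos 1≤u) (⟦⟧-pos 1≤v) c∈τ 1≤a 1≤b ab∉τ))))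

module Ratios where

  open Embedding
  open LinearForms
  open Hooks using (HookBound; HookSeparated; hookBound-transfer)
  open import Data.Nat as ℕ using (ℕ; suc)
  import Data.Nat.Properties as ℕP
  open import Data.Integer using (+_)
  open import Data.List using (List)
  open import Data.Rational using (ℚ; 0ℚ; 1ℚ; _<_; _≤_; _+_; _*_; _-_; _/_; nonNegative; positive)
  open import Data.Rational.Properties
  open import Data.Rational.Solver using (module +-*-Solver)
  open +-*-Solver using (solve; _:+_; _:*_; _:-_; con; _:=_)
  open import Data.Product using (_,_; proj₁; proj₂)
  open import Relation.Binary.PropositionalEquality

  weight-scaled : ∀ p q {d} → suc d ≡ p ℕ.+ q → ∀ c → weight (+ p / suc d) c * ⟦ suc d ⟧ ≡ ⟦ form p q c ⟧
  weight-scaled p q {d} d+1≡p+q (a , b) = begin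
    (t * ⟦ a ⟧ + (1ℚ - t) * ⟦ b ⟧) * D
      ≡⟨ solve 4 (λ t a b D → (t :* a :+ (con 1ℚ :- t) :* b) :* D := (t :* D) :* a :+ (D :- t :* D) :* b)
           refl t ⟦ a ⟧ ⟦ b ⟧ D ⟩
    (t * D) * ⟦ a ⟧ + (D - t * D) * ⟦ b ⟧
      ≡⟨ cong₂ (λ tD D → tD * ⟦ a ⟧ + (D - tD) * ⟦ b ⟧) (/-*-denominator p d) (trans (cong ⟦_⟧ d+1≡p+q) (⟦⟧-+ p q)) ⟩
    ⟦ p ⟧ * ⟦ a ⟧ + (⟦ p ⟧ + ⟦ q ⟧ - ⟦ p ⟧) * ⟦ b ⟧
      ≡⟨ solve 4 (λ p q a b → p :* a :+ (p :+ q :- p) :* b := p :* a :+ q :* b) refl ⟦ p ⟧ ⟦ q ⟧ ⟦ a ⟧ ⟦ b ⟧ ⟩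
    ⟦ p ⟧ * ⟦ a ⟧ + ⟦ q ⟧ * ⟦ b ⟧
      ≡⟨ cong₂ _+_ (⟦⟧-* p a) (⟦⟧-* q b) ⟨
    ⟦ p ℕ.* a ⟧ + ⟦ q ℕ.* b ⟧
      ≡⟨ ⟦⟧-+ (p ℕ.* a) (q ℕ.* b) ⟨
    ⟦ form p q (a , b) ⟧ ∎
    where
    open ≡-Reasoning
    t D : ℚ
    t = + p / suc d
    D = ⟦ suc d ⟧

  module _ {p q d} (d+1≡p+q : suc d ≡ p ℕ.+ q) where

    weight-≤⇒form-≤ : ∀ {x y} → weight (+ p / suc d) x ≤ weight (+ p / suc d) y → form p q x ℕ.≤ form p q y
    weight-≤⇒form-≤ {x} {y} x≤y = ⟦⟧-cancel-≤ (subst₂ _≤_ (weight-scaled p q d+1≡p+q x) (weight-scaled p q d+1≡p+q y)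
      (*-monoʳ-≤-nonNeg ⟦ suc d ⟧ {{nonNegative (⟦⟧-nonNeg (suc d))}} x≤y))

    form-≤⇒weight-≤ : ∀ {x y} → form p q x ℕ.≤ form p q y → weight (+ p / suc d) x ≤ weight (+ p / suc d) y
    form-≤⇒weight-≤ {x} {y} x≤y = *-cancelʳ-≤-pos ⟦ suc d ⟧ {{positive (⟦suc⟧-pos d)}}
      (subst₂ _≤_ (sym (weight-scaled p q d+1≡p+q x)) (sym (weight-scaled p q d+1≡p+q y)) (⟦⟧-mono-≤ x≤y))

    rightmost⇒lexMaximises : ∀ {τ m c} → IsMaxOver τ (weight (+ p / suc d)) m →
                             IsRightmostMaximizer τ (+ p / suc d) m c → LexMaximises τ (form p q) proj₁ c
    rightmost⇒lexMaximises {c = c} (_ , ≤m) (c∈τ , refl , rightmost) =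
      (c∈τ , λ {d} d∈τ → weight-≤⇒form-≤ (≤m d d∈τ)) ,
      λ { {a , b} d∈τ d≡c → rightmost a b d∈τ (≤-antisym (≤m (a , b) d∈τ) (form-≤⇒weight-≤ (ℕP.≤-reflexive (sym d≡c)))) }

    uppermost⇒lexMaximises : ∀ {τ m c} → IsMaxOver τ (weight (+ p / suc d)) m →
                             IsUppermostMaximizer τ (+ p / suc d) m c → LexMaximises τ (form p q) proj₂ c
    uppermost⇒lexMaximises {c = c} (_ , ≤m) (c∈τ , refl , uppermost) =
      (c∈τ , λ {d} d∈τ → weight-≤⇒form-≤ (≤m d d∈τ)) ,
      λ { {a , b} d∈τ d≡c → uppermost a b d∈τ (≤-antisym (≤m (a , b) d∈τ) (form-≤⇒weight-≤ (ℕP.≤-reflexive (sym d≡c)))) }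

  lowerRatio-lexMaximises : ∀ {τ e m c} → IsMaxOver τ (weight (lowerRatio τ e)) m →
    IsRightmostMaximizer τ (lowerRatio τ e) m c → LexMaximises τ (form (leg τ e) (suc (arm τ e))) proj₁ c
  lowerRatio-lexMaximises {τ} {e} {m} {c} = rightmost⇒lexMaximises {leg τ e} {suc (arm τ e)} {arm τ e ℕ.+ leg τ e}
    (trans (cong suc (ℕP.+-comm (arm τ e) (leg τ e))) (sym (ℕP.+-suc (leg τ e) (arm τ e)))) {τ} {m} {c}

  upperRatio-lexMaximises : ∀ {τ e m c} → IsMaxOver τ (weight (upperRatio τ e)) m →
    IsUppermostMaximizer τ (upperRatio τ e) m c → LexMaximises τ (form (suc (leg τ e)) (arm τ e)) proj₂ c
  upperRatio-lexMaximises {τ} {e} {m} {c} = uppermost⇒lexMaximises {suc (leg τ e)} {arm τ e} {arm τ e ℕ.+ leg τ e}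
    (cong suc (ℕP.+-comm (arm τ e) (leg τ e))) {τ} {m} {c}

  ratio-≤ : ∀ m d m′ d′ → + m / suc d ≤ + m′ / suc d′ → m ℕ.* suc d′ ℕ.≤ m′ ℕ.* suc d
  ratio-≤ m d m′ d′ r≤r′ = ⟦⟧-cancel-≤ (subst₂ _≤_ cleared cleared′
    (*-monoʳ-≤-nonNeg D′ {{nonNegative (⟦⟧-nonNeg (suc d′))}} (*-monoʳ-≤-nonNeg D {{nonNegative (⟦⟧-nonNeg (suc d))}} r≤r′)))
    where
    D D′ : ℚ
    D = ⟦ suc d ⟧
    D′ = ⟦ suc d′ ⟧
    cleared : (+ m / suc d) * D * D′ ≡ ⟦ m ℕ.* suc d′ ⟧
    cleared = trans (cong (_* D′) (/-*-denominator m d)) (sym (⟦⟧-* m (suc d′)))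
    cleared′ : (+ m′ / suc d′) * D * D′ ≡ ⟦ m′ ℕ.* suc d ⟧
    cleared′ = begin
      (+ m′ / suc d′) * D * D′  ≡⟨ solve 3 (λ r D D′ → r :* D :* D′ := r :* D′ :* D) refl (+ m′ / suc d′) D D′ ⟩
      (+ m′ / suc d′) * D′ * D  ≡⟨ cong (_* D) (/-*-denominator m′ d′) ⟩
      ⟦ m′ ⟧ * D                ≡⟨ ⟦⟧-* m′ (suc d) ⟨
      ⟦ m′ ℕ.* suc d ⟧          ∎
      where open ≡-Reasoning

  lowerRatio-≤ : ∀ {τ c e} → lowerRatio τ c ≤ lowerRatio τ e →
                 leg τ c ℕ.* suc (arm τ e ℕ.+ leg τ e) ℕ.≤ leg τ e ℕ.* suc (arm τ c ℕ.+ leg τ c)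
  lowerRatio-≤ {τ} {c} {e} = ratio-≤ (leg τ c) (arm τ c ℕ.+ leg τ c) (leg τ e) (arm τ e ℕ.+ leg τ e)

  upperRatio-≤ : ∀ {τ c e} → upperRatio τ e ≤ upperRatio τ c →
                 arm τ c ℕ.* suc (leg τ e ℕ.+ arm τ e) ℕ.≤ arm τ e ℕ.* suc (leg τ c ℕ.+ arm τ c)
  upperRatio-≤ {τ} {c} {e} r≤r′ =
    complement-≤ {suc (leg τ e)} {arm τ e} {suc (leg τ c)} {arm τ c}
      (cong suc (ℕP.+-comm (arm τ e) (leg τ e))) (cong suc (ℕP.+-comm (arm τ c) (leg τ c)))
      (ratio-≤ (suc (leg τ e)) (arm τ e ℕ.+ leg τ e) (suc (leg τ c)) (arm τ c ℕ.+ leg τ c) r≤r′)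

  hookBound-ℕ : ∀ {u v α β} → v ℕ.* β ℕ.< u ℕ.* suc α → HookBound ⟦ u ⟧ ⟦ v ⟧ α β
  hookBound-ℕ {u} {v} {α} {β} vβ<uα = subst₂ _<_ (trans (⟦⟧-* v β) (*-comm ⟦ v ⟧ ⟦ β ⟧))
                                                  (trans (⟦⟧-* u (suc α)) (*-comm ⟦ u ⟧ ⟦ suc α ⟧)) (⟦⟧-mono-< vβ<uα)

  hookSeparated-of-extremal : ∀ {τ e⁻ e⁺ u v} → 0ℚ ≤ u → 0ℚ ≤ v →
    (∀ c → c ∈τ τ → lowerRatio τ c ≤ lowerRatio τ e⁻) → (∀ c → c ∈τ τ → upperRatio τ e⁺ ≤ upperRatio τ c) →
    HookBound u v (arm τ e⁻) (leg τ e⁻) → HookBound v u (leg τ e⁺) (arm τ e⁺) → HookSeparated τ u v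
  hookSeparated-of-extremal {τ} {e⁻} {e⁺} 0≤u 0≤v ≤lowerRatio upperRatio≤ bound⁻ bound⁺ {c} c∈τ =
    hookBound-transfer {α = arm τ e⁻} {leg τ e⁻} {arm τ c} {leg τ c} 0≤v
      (lowerRatio-≤ {τ} {c} {e⁻} (≤lowerRatio c c∈τ)) bound⁻ ,
    hookBound-transfer {α = leg τ e⁺} {arm τ e⁺} {leg τ c} {arm τ c} 0≤u
      (upperRatio-≤ {τ} {c} {e⁺} (upperRatio≤ c c∈τ)) bound⁺


module RemovableCells where

  open Embedding
  open YoungDiagram
  open LinearForms
  open Cuts
  open Hooks
  open Ratios
  open import Data.Nat as ℕ using (ℕ; suc; z≤n; s≤s)
  import Data.Nat.Properties as ℕP
  open import Data.List using (List; length)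
  open import Data.Rational using (_<_; _≤_; _*_)
  open import Data.Rational.Properties using (<⇒≤; ≰⇒>) renaming (_≤?_ to _≤ℚ?_)
  open import Data.Product using (_×_; _,_; proj₁; proj₂)
  open import Data.Product.Properties using (≡-dec)
  open import Data.Sum using (inj₁; inj₂)
  open import Data.Empty using (⊥; ⊥-elim)
  open import Function using (_∘_)
  open import Relation.Binary.PropositionalEquality
  open import Relation.Nullary using (¬_; Dec; yes; no)

  module WithExtremalHooks {τ : List ℕ} (↓ : Decreasing τ) (triangular : Triangular τ)
           {e⁻ e⁺ : Cell} (e⁻∈τ : e⁻ ∈τ τ) (e⁺∈τ : e⁺ ∈τ τ)
           (≤lowerRatio : ∀ c → c ∈τ τ → lowerRatio τ c ≤ lowerRatio τ e⁻)
           (upperRatio≤ : ∀ c → c ∈τ τ → upperRatio τ e⁺ ≤ upperRatio τ c) where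

    private
      α⁻ β⁻ α⁺ β⁺ : ℕ
      α⁻ = arm τ e⁻
      β⁻ = leg τ e⁻
      α⁺ = arm τ e⁺
      β⁺ = leg τ e⁺

    F⁻ F⁺ : Cell → ℕ
    F⁻ = form β⁻ (suc α⁻)
    F⁺ = form (suc β⁺) α⁺

    private
      t⁻<t⁺ : β⁻ ℕ.* α⁺ ℕ.< suc α⁻ ℕ.* suc β⁺
      t⁻<t⁺ = from-cut (triangular⇒cut triangular)
        where
        from-cut : LinearCut (_∈τ τ) → β⁻ ℕ.* α⁺ ℕ.< suc α⁻ ℕ.* suc β⁺
        from-cut (u₀ , v₀ , 0<u₀ , 0<v₀ , cut₀) = hookBounds⇒lowerRatio<upperRatio {α = α⁻} {β⁻} {α⁺} {β⁺} 0<u₀ 0<v₀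
          (proj₁ (cut⇒hookSeparated ↓ cut₀ e⁻∈τ)) (proj₂ (cut⇒hookSeparated ↓ cut₀ e⁺∈τ))

      N : ℕ
      N = suc (part τ 1 ℕ.+ length τ)

      ≤width⇒<N : ∀ {n} → n ℕ.≤ part τ 1 → n ℕ.< N
      ≤width⇒<N n≤width = s≤s (ℕP.≤-trans n≤width (ℕP.m≤m+n (part τ 1) (length τ)))

      ≤height⇒<N : ∀ {n} → n ℕ.≤ length τ → n ℕ.< N
      ≤height⇒<N n≤height = s≤s (ℕP.≤-trans n≤height (ℕP.m≤n+m (length τ) (part τ 1)))

    removable⁻ : ∀ {c} → LexMaximises τ F⁻ proj₁ c → Removable τ c
    removable⁻ {c} lexMax = removable-of-strict-max ↓ {u} {v} (ℕP.m≤n+m 1 (N ℕ.* β⁻)) (s≤s z≤n) separated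
                              (proj₁ (proj₁ lexMax)) below-c
      where
      u v : ℕ
      u = N ℕ.* β⁻ ℕ.+ 1
      v = N ℕ.* suc α⁻
      separated : HookSeparated τ ⟦ u ⟧ ⟦ v ⟧
      separated = hookSeparated-of-extremal {τ} {e⁻} {e⁺} (⟦⟧-nonNeg u) (⟦⟧-nonNeg v) ≤lowerRatio upperRatio≤
        (hookBound-ℕ {u} {v} {α⁻} {β⁻} (perturb-exact N α⁻ β⁻))
        (hookBound-ℕ {v} {u} {β⁺} {α⁺} (subst (u ℕ.* α⁺ ℕ.<_) (sym (ℕP.*-assoc N (suc α⁻) (suc β⁺)))
                              (perturb-gap N β⁻ α⁺ t⁻<t⁺ (≤width⇒<N (arm≤width ↓ e⁺∈τ)))))
      below-c : ∀ {d} → d ∈τ τ → d ≢ c → form u v d ℕ.< form u v c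
      below-c {d} d∈τ d≢c = subst₂ ℕ._<_ (sym (perturbed-form₁ N β⁻ (suc α⁻) d)) (sym (perturbed-form₁ N β⁻ (suc α⁻) c))
        (lexMaximiser-strict {τ} F⁻ proj₁ N lexMax (≤width⇒<N ∘ column≤width ↓) (form-columnInjective β⁻ α⁻) d∈τ d≢c)

    removable⁺ : ∀ {c} → LexMaximises τ F⁺ proj₂ c → Removable τ c
    removable⁺ {c} lexMax = removable-of-strict-max ↓ {u} {v} (s≤s z≤n) (ℕP.m≤n+m 1 (N ℕ.* α⁺)) separated
                              (proj₁ (proj₁ lexMax)) below-c
      where
      u v : ℕ
      u = N ℕ.* suc β⁺
      v = N ℕ.* α⁺ ℕ.+ 1
      t⁻<t⁺′ : α⁺ ℕ.* β⁻ ℕ.< suc β⁺ ℕ.* suc α⁻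
      t⁻<t⁺′ = subst₂ ℕ._<_ (ℕP.*-comm β⁻ α⁺) (ℕP.*-comm (suc α⁻) (suc β⁺)) t⁻<t⁺
      separated : HookSeparated τ ⟦ u ⟧ ⟦ v ⟧
      separated = hookSeparated-of-extremal {τ} {e⁻} {e⁺} (⟦⟧-nonNeg u) (⟦⟧-nonNeg v) ≤lowerRatio upperRatio≤
        (hookBound-ℕ {u} {v} {α⁻} {β⁻} (subst (v ℕ.* β⁻ ℕ.<_) (sym (ℕP.*-assoc N (suc β⁺) (suc α⁻)))
                              (perturb-gap N α⁺ β⁻ t⁻<t⁺′ (≤height⇒<N (leg≤height ↓ e⁻∈τ)))))
        (hookBound-ℕ {v} {u} {β⁺} {α⁺} (perturb-exact N β⁺ α⁺))
      below-c : ∀ {d} → d ∈τ τ → d ≢ c → form u v d ℕ.< form u v c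
      below-c {d} d∈τ d≢c = subst₂ ℕ._<_ (sym (perturbed-form₂ N (suc β⁺) α⁺ d)) (sym (perturbed-form₂ N (suc β⁺) α⁺ c))
        (lexMaximiser-strict {τ} F⁺ proj₂ N lexMax (≤height⇒<N ∘ row≤height ↓) (form-rowInjective β⁺ α⁺) d∈τ d≢c)

    private
      i⁺ j⁻ : ℕ
      i⁺ = proj₁ e⁺
      j⁻ = proj₂ e⁻
      pastRowEnd⁻ pastColumnTop⁺ : Cell
      pastRowEnd⁻ = (suc (part τ j⁻) , j⁻)
      pastColumnTop⁺ = (i⁺ , suc (conj τ i⁺))

      pastRowEnd⁻≤ : ∀ {c} → Maximises τ F⁻ c → F⁻ pastRowEnd⁻ ℕ.≤ F⁻ c
      pastRowEnd⁻≤ {c} (_ , F⁻≤) = subst (ℕ._≤ F⁻ c) (form-columnTop≡form-pastRowEnd ↓ e⁻∈τ) (F⁻≤ (columnTop∈τ ↓ e⁻∈τ))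

      pastColumnTop⁺≤ : ∀ {c} → Maximises τ F⁺ c → F⁺ pastColumnTop⁺ ℕ.≤ F⁺ c
      pastColumnTop⁺≤ {c} (_ , F⁺≤) = subst (ℕ._≤ F⁺ c) (form-rowEnd≡form-pastColumnTop ↓ e⁺∈τ) (F⁺≤ (rowEnd∈τ ↓ e⁺∈τ))

      maximiser-leftOf-pastRowEnd : ∀ {c} → LinearCut (_∈τ τ) → Maximises τ F⁻ c → proj₁ c ℕ.≤ part τ j⁻
      maximiser-leftOf-pastRowEnd {c} (u₀ , v₀ , _ , 0<v₀ , cut₀) max⁻@(c∈τ , _) = ℕP.≮⇒≥ λ part<a →
        <⇒≱ (cut-separates cut₀ c pastRowEnd⁻ c∈τ (pastRowEnd∉τ ↓ j⁻) (s≤s z≤n) (proj₁ (proj₂ e⁻∈τ)))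
            (form-≤⇒level-≤ α⁻ β⁻ c pastRowEnd⁻ (<⇒≤ 0<v₀) (pastRowEnd⁻≤ max⁻)
              (inj₁ (<⇒≤ (proj₁ (cut⇒hookSeparated ↓ cut₀ e⁻∈τ)) , part<a)))

      maximiser-below-pastColumnTop : ∀ {c} → LinearCut (_∈τ τ) → Maximises τ F⁺ c → proj₂ c ℕ.≤ conj τ i⁺
      maximiser-below-pastColumnTop {c} (u₀ , v₀ , 0<u₀ , _ , cut₀) max⁺@(c∈τ , _) = ℕP.≮⇒≥ λ conj<b →
        <⇒≱ (cut-separates cut₀ c pastColumnTop⁺ c∈τ (pastColumnTop∉τ ↓ i⁺) (proj₁ e⁺∈τ) (s≤s z≤n))
            (form-≤⇒level-≤′ α⁺ β⁺ c pastColumnTop⁺ (<⇒≤ 0<u₀) (pastColumnTop⁺≤ max⁺)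
              (inj₁ (<⇒≤ (proj₂ (cut⇒hookSeparated ↓ cut₀ e⁺∈τ)) , conj<b)))

    no-other-removable : ∀ {c₁ c} → Maximises τ F⁻ c₁ → Maximises τ F⁺ c₁ → c ∈τ τ → c ≢ c₁ →
                         LinearCut (λ d → d ∈τ τ × d ≢ c) → ⊥
    no-other-removable {c₁@(a₁ , b₁)} {c@(a , b)} max⁻@(c₁∈τ , F⁻≤) max⁺@(_ , F⁺≤) c∈τ@(1≤a , 1≤b , _) c≢c₁
                       (u , v , 0<u , 0<v , cut) =
      by-slope (⟦ suc α⁻ ⟧ * u ≤ℚ? ⟦ β⁻ ⟧ * v) (⟦ suc β⁺ ⟧ * v ≤ℚ? ⟦ α⁺ ⟧ * u)
      where
      not-below : ∀ y → ¬ (y ∈τ τ × y ≢ c) → 1 ℕ.≤ proj₁ y → 1 ℕ.≤ proj₂ y → ¬ (level u v y ≤ level u v c₁)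
      not-below y y∉S 1≤y₁ 1≤y₂ = <⇒≱ (cut-separates cut c₁ y (c₁∈τ , c≢c₁ ∘ sym) y∉S 1≤y₁ 1≤y₂)
      c∉S : ¬ (c ∈τ τ × c ≢ c)
      c∉S (_ , c≢c) = c≢c refl
      by-position : Dec (a ℕ.≤ a₁) → Dec (b ℕ.≤ b₁) → ⟦ β⁻ ⟧ * v < ⟦ suc α⁻ ⟧ * u → ⟦ α⁺ ⟧ * u < ⟦ suc β⁺ ⟧ * v → ⊥
      by-position (yes a≤a₁) _ Bv<Au _ =
        not-below c c∉S 1≤a 1≤b (form-≤⇒level-≤ α⁻ β⁻ c₁ c (<⇒≤ 0<v) (F⁻≤ c∈τ) (inj₁ (<⇒≤ Bv<Au , a≤a₁)))
      by-position (no _) (yes b≤b₁) _ Qu<Pv =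
        not-below c c∉S 1≤a 1≤b (form-≤⇒level-≤′ α⁺ β⁺ c₁ c (<⇒≤ 0<u) (F⁺≤ c∈τ) (inj₁ (<⇒≤ Qu<Pv , b≤b₁)))
      by-position (no a≰a₁) (no b≰b₁) _ _ =
        ℕP.<⇒≱ (form-northEast-< β⁻ α⁻ (ℕP.<⇒≤ (ℕP.≰⇒> a≰a₁)) (ℕP.≰⇒> b≰b₁)) (F⁻≤ c∈τ)
      by-slope : Dec (⟦ suc α⁻ ⟧ * u ≤ ⟦ β⁻ ⟧ * v) → Dec (⟦ suc β⁺ ⟧ * v ≤ ⟦ α⁺ ⟧ * u) → ⊥
      by-slope (yes Au≤Bv) _ =
        not-below pastRowEnd⁻ (pastRowEnd∉τ ↓ j⁻ ∘ proj₁) (s≤s z≤n) (proj₁ (proj₂ e⁻∈τ))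
          (form-≤⇒level-≤ α⁻ β⁻ c₁ pastRowEnd⁻ (<⇒≤ 0<v) (pastRowEnd⁻≤ max⁻)
            (inj₂ (Au≤Bv , ℕP.m≤n⇒m≤1+n (maximiser-leftOf-pastRowEnd (triangular⇒cut triangular) max⁻))))
      by-slope (no _) (yes Pv≤Qu) =
        not-below pastColumnTop⁺ (pastColumnTop∉τ ↓ i⁺ ∘ proj₁) (proj₁ e⁺∈τ) (s≤s z≤n)
          (form-≤⇒level-≤′ α⁺ β⁺ c₁ pastColumnTop⁺ (<⇒≤ 0<u) (pastColumnTop⁺≤ max⁺)
            (inj₂ (Pv≤Qu , ℕP.m≤n⇒m≤1+n (maximiser-below-pastColumnTop (triangular⇒cut triangular) max⁺))))
      by-slope (no Au≰Bv) (no Pv≰Qu) = by-position (a ℕ.≤? a₁) (b ℕ.≤? b₁) (≰⇒> Au≰Bv) (≰⇒> Pv≰Qu)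

    removable-unique : ∀ {c₁ c} → Maximises τ F⁻ c₁ → Maximises τ F⁺ c₁ → Removable τ c → c ≡ c₁
    removable-unique {c₁} {c} max⁻ max⁺ (c∈τ , c-removed-triangular) = decided (≡-dec ℕ._≟_ ℕ._≟_ c c₁)
      where
      decided : Dec (c ≡ c₁) → c ≡ c₁
      decided (yes c≡c₁) = c≡c₁
      decided (no c≢c₁) = ⊥-elim (no-other-removable max⁻ max⁺ c∈τ c≢c₁ (triangular⇒cut c-removed-triangular))

open LinearForms using (Maximises; LexMaximises)
open Cuts using (triangular⇒cut)
open Ratios using (lowerRatio-lexMaximises; upperRatio-lexMaximises)
open RemovableCells

proposition3p6 :
    (τ : List ℕ) → IsPartition τ → τ ≢ [] → Triangular τ →
    (t⁻ t⁺ m⁻ m⁺ : ℚ) (c⁻ c⁺ : Cell) →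
    IsMaxOver τ (lowerRatio τ) t⁻ →
    IsMinOver τ (upperRatio τ) t⁺ →
    IsMaxOver τ (weight t⁻) m⁻ →
    IsRightmostMaximizer τ t⁻ m⁻ c⁻ →
    IsMaxOver τ (weight t⁺) m⁺ →
    IsUppermostMaximizer τ t⁺ m⁺ c⁺ →
    (c⁻ ≡ c⁺ → Removable τ c⁻ × (∀ c → Removable τ c → c ≡ c⁻))
    × (c⁻ ≢ c⁺ → Removable τ c⁻ × Removable τ c⁺)
proposition3p6 τ (_ , ↓) _ triangular _ _ _ _ c⁻ c⁺ ((e⁻ , e⁻∈τ , refl) , ≤lowerRatio) ((e⁺ , e⁺∈τ , refl) , upperRatio≤)
  max⁻ rightmost max⁺ uppermost =
  (λ c⁻≡c⁺ → removable⁻ lex⁻ , λ c c-removable →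
     removable-unique (proj₁ lex⁻) (subst (Maximises τ F⁺) (sym c⁻≡c⁺) (proj₁ lex⁺)) c-removable) ,
  (λ _ → removable⁻ lex⁻ , removable⁺ lex⁺)
  where
  open WithExtremalHooks ↓ triangular e⁻∈τ e⁺∈τ ≤lowerRatio upperRatio≤
  lex⁻ : LexMaximises τ F⁻ proj₁ c⁻
  lex⁻ = lowerRatio-lexMaximises {τ} {e⁻} max⁻ rightmost
  lex⁺ : LexMaximises τ F⁺ proj₂ c⁺
  lex⁺ = upperRatio-lexMaximises {τ} {e⁺} max⁺ uppermost
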